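{- Let $\kappa,\lambda$ be ordinals. Let $\langle M_\alpha:\alpha<\kappa\rangle$, $\langle N_\alpha:\alpha<\kappa\rangle$, $\langle P_\beta:\beta<\lambda\rangle$ and $\langle Q_\beta:\beta<\lambda\rangle$ each be a sequence of non-empty, pairwise disjoint sets. If $$\bigcup_{\alpha<\kappa}M_\alpha\times N_\alpha\subseteq\bigcup_{\beta<\lambda}P_\beta\times Q_\beta,$$ then there is a uniquely determined mapping $\vartheta:\kappa\to\lambda$ such that $M_\alpha\subseteq P_{\vartheta(\alpha)}$ and $N_\alpha\subseteq Q_{\vartheta(\alpha)}$ for each $\alpha<\kappa$. If equality holds in the displayed inclusion, then $M_\alpha=P_{\vartheta(\alpha)}$ and $N_\alpha=Q_{\vartheta(\alpha)}$ for each $\alpha<\kappa$, and $\vartheta$ is a bijection. -}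

module Defs where

open import Level using (Level; _⊔_)
open import Data.Product using (Σ; ∃; _×_; _,_)
open import Relation.Unary using (Pred; _∈_)
open import Relation.Binary.PropositionalEquality using (_≡_)

private
  variable
    i a ℓ : Level

-- A family of sets indexed by I is pairwise disjoint: two members sharing
-- an element have the same index (contrapositive of: α ≢ β → M α ∩ M β = ∅).
PairwiseDisjoint : {I : Set i} {A : Set a} → (I → Pred A ℓ) → Set (i ⊔ a ⊔ ℓ)
PairwiseDisjoint {I = I} {A = A} M =
  ∀ {α β : I} {x : A} → x ∈ M α → x ∈ M β → α ≡ β

⋃× : ∀ {b} {I : Set i} {A : Set a} {B : Set b} →
     (I → Pred A ℓ) → (I → Pred B ℓ) → Pred (A × B) (i ⊔ ℓ)
⋃× {I = I} M N (x , y) = Σ I λ α → x ∈ M α × y ∈ N α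

module Submission where

-- The whole lemma rests on one
-- observation (rectangle-in-block): a nonempty rectangle X × Y contained in
-- a union of rectangles P β × Q β with both families pairwise disjoint lies
-- inside a single one of them.  Fix x₀ ∈ X, y₀ ∈ Y and let β be the block
-- containing (x₀ , y₀); for x ∈ X the point (x , y₀) lies in some block β′,
-- and y₀ ∈ Q β ∩ Q β′ forces β′ = β, so x ∈ P β; symmetrically Y ⊆ Q β.
--
-- Applying this to every rectangle M α × N α yields the map ϑ (refinement);
-- it is unique because the block containing a nonempty set is unique
-- (containing-index-unique).  Under equality of the unions, the same argument
-- in the opposite direction gives ψ with P β ⊆ M (ψ β), Q β ⊆ N (ψ β).  Then
-- M α ⊆ P (ϑ α) ⊆ M (ψ (ϑ α)) forces ψ (ϑ α) = α (refinement-retraction), so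
-- all inclusions are equalities and ϑ, ψ are mutually inverse bijections.

open import Defs
open import Level using (Level; _⊔_)
open import Data.Product using (Σ; _×_; _,_; proj₁; proj₂)
open import Function using (id; _∘_)
open import Relation.Unary using (Pred; _∈_; _⊆_; _≐_; Satisfiable)
open import Relation.Binary.PropositionalEquality using (_≡_; subst)
open import Function.Definitions using (Bijective)
open import Function.Consequences.Propositional
  using (inverseᵇ⇒bijective; strictlyInverseˡ⇒inverseˡ; strictlyInverseʳ⇒inverseʳ)

private
  variable
    i j a b ℓ ℓ′ : Level
    I : Set i
    J : Set j
    A : Set a
    B : Set b

containing-index-unique : {P : J → Pred A ℓ} {X : Pred A ℓ′} →
  PairwiseDisjoint P → Satisfiable X →
  ∀ {β β′} → X ⊆ P β → X ⊆ P β′ → β ≡ β′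
containing-index-unique dP (x , x∈X) X⊆Pβ X⊆Pβ′ = dP (X⊆Pβ x∈X) (X⊆Pβ′ x∈X)

rectangle-in-block : {P : J → Pred A ℓ} {Q : J → Pred B ℓ}
  {X : Pred A ℓ′} {Y : Pred B ℓ′} →
  PairwiseDisjoint P → PairwiseDisjoint Q → Satisfiable X → Satisfiable Y →
  (∀ {x y} → x ∈ X → y ∈ Y → (x , y) ∈ ⋃× P Q) →
  Σ J λ β → X ⊆ P β × Y ⊆ Q β
rectangle-in-block {P = P} {Q} {X} {Y} dP dQ (x₀ , x₀∈X) (y₀ , y₀∈Y) X×Y⊆PQ
  with X×Y⊆PQ x₀∈X y₀∈Y
... | β , x₀∈Pβ , y₀∈Qβ = β , X⊆Pβ , Y⊆Qβ
  where
  -- (x , y₀) lies in a block whose Q-side meets Q β in y₀, hence is block β.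
  X⊆Pβ : X ⊆ P β
  X⊆Pβ {x} x∈X with X×Y⊆PQ x∈X y₀∈Y
  ... | β′ , x∈Pβ′ , y₀∈Qβ′ = subst (λ γ → x ∈ P γ) (dQ y₀∈Qβ′ y₀∈Qβ) x∈Pβ′

  -- Symmetrically, (x₀ , y) lies in a block whose P-side meets P β in x₀.
  Y⊆Qβ : Y ⊆ Q β
  Y⊆Qβ {y} y∈Y with X×Y⊆PQ x₀∈X y∈Y
  ... | β′ , x₀∈Pβ′ , y∈Qβ′ = subst (λ γ → y ∈ Q γ) (dP x₀∈Pβ′ x₀∈Pβ) y∈Qβ′

Refines : {I : Set i} {J : Set j} {A : Set a} {B : Set b} →
  (I → Pred A ℓ) → (I → Pred B ℓ) → (J → Pred A ℓ′) → (J → Pred B ℓ′) →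
  (I → J) → Set (i ⊔ a ⊔ b ⊔ ℓ ⊔ ℓ′)
Refines M N P Q ϑ = ∀ α → M α ⊆ P (ϑ α) × N α ⊆ Q (ϑ α)

refinement : {M : I → Pred A ℓ} {N : I → Pred B ℓ}
  {P : J → Pred A ℓ} {Q : J → Pred B ℓ} →
  (∀ α → Satisfiable (M α)) → (∀ α → Satisfiable (N α)) →
  PairwiseDisjoint P → PairwiseDisjoint Q →
  ⋃× M N ⊆ ⋃× P Q → Σ (I → J) (Refines M N P Q)
refinement {J = J} {M = M} {N} {P} {Q} sM sN dP dQ MN⊆PQ =
  proj₁ ∘ block , proj₂ ∘ block
  where
  block : ∀ α → Σ J λ β → M α ⊆ P β × N α ⊆ Q β
  block α = rectangle-in-block dP dQ (sM α) (sN α)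
                  (λ x∈Mα y∈Nα → MN⊆PQ (α , x∈Mα , y∈Nα))

-- A refining map is unique, since each nonempty M α lies in only one P β.
refinement-unique : {M : I → Pred A ℓ} {N : I → Pred B ℓ}
  {P : J → Pred A ℓ′} {Q : J → Pred B ℓ′} {ϑ ϑ′ : I → J} →
  (∀ α → Satisfiable (M α)) → PairwiseDisjoint P →
  Refines M N P Q ϑ → Refines M N P Q ϑ′ → ∀ α → ϑ′ α ≡ ϑ α
refinement-unique sM dP ϑ-refines ϑ′-refines α =
  containing-index-unique dP (sM α) (proj₁ (ϑ′-refines α)) (proj₁ (ϑ-refines α))

-- Refining back and forth returns to the start: M α ⊆ M (ψ (ϑ α)) and M α is
-- nonempty, so disjointness of M gives ψ (ϑ α) = α.
refinement-retraction : {M : I → Pred A ℓ} {N : I → Pred B ℓ}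
  {P : J → Pred A ℓ} {Q : J → Pred B ℓ} {ϑ : I → J} {ψ : J → I} →
  (∀ α → Satisfiable (M α)) → PairwiseDisjoint M →
  Refines M N P Q ϑ → Refines P Q M N ψ → ∀ α → ψ (ϑ α) ≡ α
refinement-retraction {ϑ = ϑ} sM dM ϑ-refines ψ-refines α =
  containing-index-unique dM (sM α)
    (proj₁ (ψ-refines (ϑ α)) ∘ proj₁ (ϑ-refines α)) id

-- Mutual refinements are exact: the chains M α ⊆ P (ϑ α) ⊆ M (ψ (ϑ α)) = M α
-- and N α ⊆ Q (ϑ α) ⊆ N (ψ (ϑ α)) = N α close up.
mutual-refinement-exact : {M : I → Pred A ℓ} {N : I → Pred B ℓ}
  {P : J → Pred A ℓ} {Q : J → Pred B ℓ} {ϑ : I → J} {ψ : J → I} →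
  (∀ α → Satisfiable (M α)) → PairwiseDisjoint M →
  Refines M N P Q ϑ → Refines P Q M N ψ →
  ∀ α → M α ≐ P (ϑ α) × N α ≐ Q (ϑ α)
mutual-refinement-exact {I = I} {M = M} {N} {ϑ = ϑ} {ψ} sM dM ϑ-refines ψ-refines α =
    (proj₁ (ϑ-refines α) , back M (proj₁ (ψ-refines (ϑ α))))
  , (proj₂ (ϑ-refines α) , back N (proj₂ (ψ-refines (ϑ α))))
  where
  ψϑα≡α : ψ (ϑ α) ≡ α
  ψϑα≡α = refinement-retraction sM dM ϑ-refines ψ-refines α

  back : ∀ {c ℓ″ ℓ‴} {C : Set c} {S : Pred C ℓ″} (R : I → Pred C ℓ‴) →
         S ⊆ R (ψ (ϑ α)) → S ⊆ R α
  back R S⊆R {z} z∈S = subst (λ γ → z ∈ R γ) ψϑα≡α (S⊆R z∈S)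

lemma3p5 : ∀ {i j a b ℓ : Level} {κ : Set i} {λ′ : Set j} {A : Set a} {B : Set b}
    (M : κ → Pred A ℓ) (N : κ → Pred B ℓ) (P : λ′ → Pred A ℓ) (Q : λ′ → Pred B ℓ) →
    (∀ α → Satisfiable (M α)) → (∀ α → Satisfiable (N α)) →
    (∀ β → Satisfiable (P β)) → (∀ β → Satisfiable (Q β)) →
    PairwiseDisjoint M → PairwiseDisjoint N →
    PairwiseDisjoint P → PairwiseDisjoint Q →
    ⋃× M N ⊆ ⋃× P Q →
    Σ (κ → λ′) λ ϑ →
    (∀ α → M α ⊆ P (ϑ α) × N α ⊆ Q (ϑ α))
    × (∀ (ϑ′ : κ → λ′) → (∀ α → M α ⊆ P (ϑ′ α) × N α ⊆ Q (ϑ′ α)) → ∀ α → ϑ′ α ≡ ϑ α)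
    × (⋃× P Q ⊆ ⋃× M N →
    (∀ α → M α ≐ P (ϑ α) × N α ≐ Q (ϑ α)) × Bijective _≡_ _≡_ ϑ)
lemma3p5 M N P Q sM sN sP sQ dM dN dP dQ MN⊆PQ
  with refinement sM sN dP dQ MN⊆PQ
... | ϑ , ϑ-refines =
  ϑ , ϑ-refines , (λ ϑ′ → refinement-unique {N = N} {Q = Q} sM dP ϑ-refines) , equality-case
  where
  equality-case : ⋃× P Q ⊆ ⋃× M N →
    (∀ α → M α ≐ P (ϑ α) × N α ≐ Q (ϑ α)) × Bijective _≡_ _≡_ ϑ
  equality-case PQ⊆MN with refinement sP sQ dM dN PQ⊆MN
  ... | ψ , ψ-refines =
      mutual-refinement-exact sM dM ϑ-refines ψ-refines
    , inverseᵇ⇒bijective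
        ( strictlyInverseˡ⇒inverseˡ ϑ (refinement-retraction sP dP ψ-refines ϑ-refines)
        , strictlyInverseʳ⇒inverseʳ ϑ (refinement-retraction sM dM ϑ-refines ψ-refines))
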